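{- Let $\mathfrak{M}=(M,\oplus,\preceq)$ be a partially ordered commutative semigroup and let $S\subseteq M$ be finite. Then for every block $\mathcal B\neq\mathbf 0$ of $\mathfrak M$ there is a distance $\mathrm{mus}(\mathcal B,S)\in\mathcal B$ such that for every $\ell\in S$ and $e\in S^\oplus$ one of the following holds: (1) $e\oplus\mathrm{mus}(\mathcal B,S)\succeq\ell$; or (2) $e\oplus b\not\succeq\ell$ for every $b\in\mathcal B$ (and consequently also for every $b\in\mathcal B'$ where $\mathcal B'\preceq\mathcal B$ is a block). Furthermore, for every block $\mathcal B$ with $\mathcal B\cap S^\oplus\neq\emptyset$, $\mathrm{mus}(\mathcal B,S)$ can be chosen in $S^\oplus$.
   Context: A partially ordered commutative semigroup is a triple $\mathfrak M=(M,\oplus,\preceq)$ where $(M,\oplus)$ is a commutative semigroup, $\preceq$ is a reflexive partial order on $M$, $a\preceq a\oplus b$ for all $a,b$, and $b\preceq c$ implies $a\oplus b\preceq a\oplus c$. $S^\oplus$ denotes the set of all nonempty finite $\oplus$-sums of elements of $S$ (the subsemigroup generated by $S$). $n\times a$ is the $n$-fold $\oplus$-sum of $a$; $\mathfrak M$ is archimedean if for all $a,b$ there is $n$ with $n\times a\succeq b$. A block of $\mathfrak M$ is a subset of $M$ inducing a maximal archimedean subsemigroup, or the special block $\mathbf 0$ corresponding to the empty set. Blocks are ordered by $\mathcal B'\preceq\mathcal B$ iff for every $a\in\mathcal B'$ there is $b\in\mathcal B$ with $a\preceq b$. -}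

module Defs where

open import Level using (Level; 0ℓ) renaming (suc to lsuc)
open import Data.Nat using (ℕ; zero; suc)
open import Data.List using (List)
open import Data.List.Membership.Propositional using (_∈_)
open import Data.Sum using (_⊎_)
open import Data.Product using (Σ; ∃; _×_; _,_)
open import Relation.Binary.PropositionalEquality using (_≡_)
open import Relation.Nullary using (¬_)

record POCSemigroup : Set₁ where
  infixl 6 _⊕_
  infix 4 _⪯_
  field
    Carrier   : Set
    _⊕_       : Carrier → Carrier → Carrier
    _⪯_       : Carrier → Carrier → Set
    ⊕-assoc   : ∀ a b c → (a ⊕ b) ⊕ c ≡ a ⊕ (b ⊕ c)
    ⊕-comm    : ∀ a b → a ⊕ b ≡ b ⊕ a
    ⪯-refl    : ∀ a → a ⪯ a
    ⪯-trans   : ∀ {a b c} → a ⪯ b → b ⪯ c → a ⪯ c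
    ⪯-antisym : ∀ {a b} → a ⪯ b → b ⪯ a → a ≡ b
    ⪯-⊕       : ∀ a b → a ⪯ a ⊕ b
    ⊕-mono    : ∀ a {b c} → b ⪯ c → a ⊕ b ⪯ a ⊕ c

module _ (𝔐 : POCSemigroup) where
  open POCSemigroup 𝔐

  Subset : Set₁
  Subset = Carrier → Set

  _⊆_ : Subset → Subset → Set
  A ⊆ B = ∀ {x} → A x → B x

  -- times n a  is the (n+1)-fold ⊕-sum of a  (i.e. (suc n) × a).
  times : ℕ → Carrier → Carrier
  times zero    a = a
  times (suc n) a = a ⊕ times n a

  IsSubsemigroup : Subset → Set
  IsSubsemigroup A = ∀ {a b} → A a → A b → A (a ⊕ b)

  IsArchimedean : Subset → Set
  IsArchimedean A = ∀ {a b} → A a → A b → ∃ λ n → b ⪯ times n a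

  IsArchSubsemigroup : Subset → Set
  IsArchSubsemigroup A = IsSubsemigroup A × IsArchimedean A

  IsBlock : Subset → Set₁
  IsBlock B = (∃ λ x → B x)
            × IsArchSubsemigroup B
            × (∀ (C : Subset) → IsArchSubsemigroup C → B ⊆ C → C ⊆ B)

  _⪯ᴮ_ : Subset → Subset → Set
  B' ⪯ᴮ B = ∀ {a} → B' a → ∃ λ b → B b × a ⪯ b

  data Gen (S : List Carrier) : Carrier → Set where
    gen : ∀ {x} → x ∈ S → Gen S x
    add : ∀ {x y} → Gen S x → Gen S y → Gen S (x ⊕ y)

  IsMus : List Carrier → Subset → Carrier → Set₁
  IsMus S B m =
    B m ×
    (∀ {ℓ e} → ℓ ∈ S → Gen S e →
       (ℓ ⪯ e ⊕ m)
       ⊎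
       ((∀ {b} → B b → ¬ (ℓ ⪯ e ⊕ b))
        × (∀ (B' : Subset) → IsBlock B' → B' ⪯ᴮ B →
             ∀ {b} → B' b → ¬ (ℓ ⪯ e ⊕ b))))

-- Fix any x ∈ B and enumerate S = s₁,…,s_k.  Every e ∈ S^⊕ acts on M
-- as the translation  b ↦ e ⊕ b = v₁×s₁ ⊕ … ⊕ v_k×s_k ⊕ b  for a vector
-- v ∈ ℕ^k of multiplicities.  For a fixed ℓ the predicate
--   "ℓ ⪯ (v-combination) ⊕ (n+1)×x"
-- is upward closed in v (pointwise) and in n, so a Dickson-type argument
-- (classical, hence the excluded middle) gives one bound c that works for
-- all v simultaneously; maximising over the finitely many ℓ ∈ S gives a
-- single c.  Then mus(B,S) = (c+1)×x: if ℓ ⪯ e ⊕ b for some b ∈ B, the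
-- archimedean property puts b below some (n+1)×x and the bound moves n to c;
-- otherwise alternative (2) holds, and it propagates to blocks below B.
-- If x is chosen in B ∩ S^⊕, then (c+1)×x ∈ S^⊕ as well.
module Submission where

open import Defs
open import Level using (0ℓ)
open import Axiom.ExcludedMiddle using (ExcludedMiddle)
open import Data.Nat using (ℕ; zero; suc; _+_; _≤_; _<_; z≤n; s≤s; _⊔_; _≤?_)
open import Data.Nat.Properties using (≤-refl; ≤-trans; m≤m⊔n; m≤n⊔m; ≰⇒>)
open import Data.List using (List; []; _∷_; length; map; upTo)
open import Data.List.Extrema.Nat using (max; xs≤max)
open import Data.List.Membership.Propositional using (_∈_)
open import Data.List.Membership.Propositional.Properties using (∈-upTo⁺)
open import Data.List.Relation.Unary.Any using (here; there)
import Data.List.Relation.Unary.All as All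
open import Data.List.Relation.Unary.All.Properties using (map⁻)
open import Data.Vec using (Vec; []; _∷_; zipWith; replicate)
open import Data.Vec.Relation.Binary.Pointwise.Inductive as Pointwise
  using (Pointwise; []; _∷_)
open import Data.Product using (∃; _×_; _,_; proj₁; proj₂)
open import Data.Sum using (_⊎_; inj₁; inj₂)
open import Data.Empty using (⊥-elim)
open import Relation.Nullary using (¬_; yes; no)
open import Relation.Binary.PropositionalEquality
  using (_≡_; refl; sym; trans; cong; subst; module ≡-Reasoning)
open ≡-Reasoning

upperBound : ∀ {A : Set} (f : A → ℕ) (L : List A) →
             ∃ λ M → ∀ {a} → a ∈ L → f a ≤ M
upperBound f L = max 0 (map f L) , All.lookup (map⁻ (xs≤max 0 (map f L)))

_≤ᵛ_ : ∀ {k} → Vec ℕ k → Vec ℕ k → Set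
_≤ᵛ_ = Pointwise _≤_

≤ᵛ-refl : ∀ {k} {u : Vec ℕ k} → u ≤ᵛ u
≤ᵛ-refl = Pointwise.refl ≤-refl

UpInVec : ∀ {k} → (Vec ℕ k → ℕ → Set) → Set
UpInVec P = ∀ {u w n} → u ≤ᵛ w → P u n → P w n

UpInℕ : ∀ {k} → (Vec ℕ k → ℕ → Set) → Set
UpInℕ P = ∀ {u n n'} → n ≤ n' → P u n → P u n'

UniformBound : ∀ {k} → ℕ → (Vec ℕ k → ℕ → Set) → Set
UniformBound c P = ∀ u n → P u n → P u c

uniformBound-weaken : ∀ {k} {P : Vec ℕ k → ℕ → Set} {c c'} →
  UpInℕ P → c ≤ c' → UniformBound c P → UniformBound c' P
uniformBound-weaken up c≤c' bound u n p = up c≤c' (bound u n p)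

-- For k+1 coordinates, with u ∈ ℕ^k and first coordinate j:
-- c∞ uniformly bounds "∃ j. P (j∷u)" and J uniformly bounds j ↦ P (j∷u) c∞;
-- so for j ≥ J the bound c∞ already suffices, and the finitely many slices
-- j < J are bounded individually.
uniformBound : ExcludedMiddle 0ℓ → ∀ k (P : Vec ℕ k → ℕ → Set) →
  UpInVec P → UpInℕ P → ∃ λ c → UniformBound c P
uniformBound em zero P upV upN with em {∃ λ n → P [] n}
... | yes (n , p) = n , λ { [] _ _ → p }
... | no ¬p       = 0 , λ { [] n p → ⊥-elim (¬p (n , p)) }
uniformBound em (suc k) P upV upN = c∞ ⊔ M , bound
  where
  someFirst : Vec ℕ k → ℕ → Set
  someFirst u n = ∃ λ j → P (j ∷ u) n

  boundSome : ∃ λ c → UniformBound c someFirst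
  boundSome = uniformBound em k someFirst
    (λ u≤w (j , p) → j , upV (≤-refl ∷ u≤w) p) (λ n≤n' (j , p) → j , upN n≤n' p)

  c∞ : ℕ
  c∞ = proj₁ boundSome

  atC∞ : Vec ℕ k → ℕ → Set
  atC∞ u j = P (j ∷ u) c∞

  boundFirst : ∃ λ J → UniformBound J atC∞
  boundFirst = uniformBound em k atC∞
    (λ u≤w p → upV (≤-refl ∷ u≤w) p) (λ j≤j' p → upV (j≤j' ∷ ≤ᵛ-refl) p)

  J : ℕ
  J = proj₁ boundFirst

  slice : ∀ j → ∃ λ c → UniformBound c (λ u → P (j ∷ u))
  slice j = uniformBound em k (λ u → P (j ∷ u)) (λ u≤w p → upV (≤-refl ∷ u≤w) p) upN

  M : ℕ
  M = proj₁ (upperBound (λ j → proj₁ (slice j)) (upTo J))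

  slice≤M : ∀ {j} → j < J → proj₁ (slice j) ≤ M
  slice≤M j<J = proj₂ (upperBound (λ j → proj₁ (slice j)) (upTo J)) (∈-upTo⁺ j<J)

  bound : UniformBound (c∞ ⊔ M) P
  bound (j ∷ u) n p with J ≤? j
  ... | yes J≤j =
    let (j' , q) = proj₂ boundSome u n (j , p)
    in upN (m≤m⊔n c∞ M) (upV (J≤j ∷ ≤ᵛ-refl) (proj₂ boundFirst u j' q))
  ... | no J≰j = uniformBound-weaken upN (≤-trans (slice≤M (≰⇒> J≰j)) (m≤n⊔m c∞ M))
                   (proj₂ (slice j)) u n p

module _ (𝔐 : POCSemigroup) where
  open POCSemigroup 𝔐

  rep : ℕ → Carrier → Carrier → Carrier
  rep zero    s c = c
  rep (suc n) s c = s ⊕ rep n s c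

  rep-+ : ∀ n m s c → rep n s (rep m s c) ≡ rep (n + m) s c
  rep-+ zero    m s c = refl
  rep-+ (suc n) m s c = cong (s ⊕_) (rep-+ n m s c)

  times≡rep : ∀ n x → times 𝔐 n x ≡ rep n x x
  times≡rep zero    x = refl
  times≡rep (suc n) x = cong (x ⊕_) (times≡rep n x)

  IsTranslation : (Carrier → Carrier) → Set
  IsTranslation f = ∀ a c → f (a ⊕ c) ≡ a ⊕ f c

  ⊕-translation : ∀ s → IsTranslation (s ⊕_)
  ⊕-translation s a c = begin
    s ⊕ (a ⊕ c)  ≡⟨ sym (⊕-assoc s a c) ⟩
    (s ⊕ a) ⊕ c  ≡⟨ cong (_⊕ c) (⊕-comm s a) ⟩
    (a ⊕ s) ⊕ c  ≡⟨ ⊕-assoc a s c ⟩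
    a ⊕ (s ⊕ c)  ∎

  ∘-translation : ∀ {f g} → IsTranslation f → IsTranslation g →
                  IsTranslation (λ c → f (g c))
  ∘-translation {f} tf tg a c = trans (cong f (tg a c)) (tf a _)

  rep-translation : ∀ n s → IsTranslation (rep n s)
  rep-translation zero    s a c = refl
  rep-translation (suc n) s = ∘-translation (⊕-translation s) (rep-translation n s)

  translation-comm-rep : ∀ {f} → IsTranslation f → ∀ m t c →
                         f (rep m t c) ≡ rep m t (f c)
  translation-comm-rep tf zero    t c = refl
  translation-comm-rep tf (suc m) t c =
    trans (tf t (rep m t c)) (cong (t ⊕_) (translation-comm-rep tf m t c))

  combine : (S : List Carrier) → Vec ℕ (length S) → Carrier → Carrier
  combine []      []      b = b
  combine (s ∷ S) (n ∷ v) b = rep n s (combine S v b)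

  combine-translation : ∀ S v → IsTranslation (combine S v)
  combine-translation []      []      a c = refl
  combine-translation (s ∷ S) (n ∷ v) =
    ∘-translation (rep-translation n s) (combine-translation S v)

  combine-+ : ∀ S v w b → combine S v (combine S w b) ≡ combine S (zipWith _+_ v w) b
  combine-+ []      []      []      b = refl
  combine-+ (s ∷ S) (n ∷ v) (m ∷ w) b = begin
    rep n s (combine S v (rep m s (combine S w b)))
      ≡⟨ cong (rep n s) (translation-comm-rep (combine-translation S v) m s _) ⟩
    rep n s (rep m s (combine S v (combine S w b)))
      ≡⟨ cong (λ z → rep n s (rep m s z)) (combine-+ S v w b) ⟩
    rep n s (rep m s (combine S (zipWith _+_ v w) b))
      ≡⟨ rep-+ n m s _ ⟩
    rep (n + m) s (combine S (zipWith _+_ v w) b)  ∎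

  unitVec : ∀ {x} {S : List Carrier} → x ∈ S → Vec ℕ (length S)
  unitVec {S = s ∷ S} (here _) = 1 ∷ replicate (length S) 0
  unitVec (there p) = 0 ∷ unitVec p

  combine-zero : ∀ S b → combine S (replicate (length S) 0) b ≡ b
  combine-zero []      b = refl
  combine-zero (s ∷ S) b = combine-zero S b

  combine-unit : ∀ {x} {S : List Carrier} (p : x ∈ S) b → combine S (unitVec p) b ≡ x ⊕ b
  combine-unit {S = s ∷ S} (here refl) b = cong (s ⊕_) (combine-zero S b)
  combine-unit (there p) b = combine-unit p b

  gen-combination : ∀ {S e} → Gen 𝔐 S e → ∃ λ v → ∀ b → e ⊕ b ≡ combine S v b
  gen-combination (gen p) = unitVec p , λ b → sym (combine-unit p b)
  gen-combination {S} (add {x} {y} g h) with gen-combination g | gen-combination h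
  ... | v , ev | w , ew = zipWith _+_ v w , λ b → begin
    (x ⊕ y) ⊕ b             ≡⟨ ⊕-assoc x y b ⟩
    x ⊕ (y ⊕ b)             ≡⟨ cong (x ⊕_) (ew b) ⟩
    x ⊕ combine S w b        ≡⟨ ev _ ⟩
    combine S v (combine S w b)  ≡⟨ combine-+ S v w b ⟩
    combine S (zipWith _+_ v w) b  ∎

  rep-monoʳ : ∀ n s {c c'} → c ⪯ c' → rep n s c ⪯ rep n s c'
  rep-monoʳ zero    s c⪯c' = c⪯c'
  rep-monoʳ (suc n) s c⪯c' = ⊕-mono s (rep-monoʳ n s c⪯c')

  rep-inflationary : ∀ m s c → c ⪯ rep m s c
  rep-inflationary zero    s c = ⪯-refl c
  rep-inflationary (suc m) s c =
    ⪯-trans (rep-inflationary m s c)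
            (subst (rep m s c ⪯_) (⊕-comm (rep m s c) s) (⪯-⊕ (rep m s c) s))

  rep-monoˡ : ∀ {n m} s c → n ≤ m → rep n s c ⪯ rep m s c
  rep-monoˡ {m = m} s c z≤n     = rep-inflationary m s c
  rep-monoˡ         s c (s≤s p) = ⊕-mono s (rep-monoˡ s c p)

  combine-mono : ∀ S {u w b b'} → u ≤ᵛ w → b ⪯ b' → combine S u b ⪯ combine S w b'
  combine-mono []      []          b⪯b' = b⪯b'
  combine-mono (s ∷ S) {n ∷ u} {m ∷ w} {b} {b'} (n≤m ∷ u≤w) b⪯b' =
    ⪯-trans (rep-monoʳ n s (combine-mono S u≤w b⪯b')) (rep-monoˡ s (combine S w b') n≤m)

  times-mono : ∀ {n n'} x → n ≤ n' → times 𝔐 n x ⪯ times 𝔐 n' x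
  times-mono {n} {n'} x n≤n'
    rewrite times≡rep n x | times≡rep n' x = rep-monoˡ x x n≤n'

  times-closed : ∀ (A : Subset 𝔐) → IsSubsemigroup 𝔐 A → ∀ {x} → A x →
                 ∀ n → A (times 𝔐 n x)
  times-closed A closed ax zero    = ax
  times-closed A closed ax (suc n) = closed ax (times-closed A closed ax n)

  gen-times : ∀ {S y} n → Gen 𝔐 S y → Gen 𝔐 S (times 𝔐 n y)
  gen-times zero    g = g
  gen-times (suc n) g = add g (gen-times n g)

  reachBound : ExcludedMiddle 0ℓ → ∀ (S : List Carrier) x (L : List Carrier) →
    ∃ λ c → ∀ {ℓ} → ℓ ∈ L → ∀ v n →
      ℓ ⪯ combine S v (times 𝔐 n x) → ℓ ⪯ combine S v (times 𝔐 c x)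
  reachBound em S x L = M , λ ℓ∈L → uniformBound-weaken upN (M-bounds ℓ∈L) (proj₂ (perℓ _))
    where
    reaches : Carrier → Vec ℕ (length S) → ℕ → Set
    reaches ℓ v n = ℓ ⪯ combine S v (times 𝔐 n x)

    upN : ∀ {ℓ} → UpInℕ (reaches ℓ)
    upN n≤n' p = ⪯-trans p (combine-mono S ≤ᵛ-refl (times-mono x n≤n'))

    perℓ : ∀ ℓ → ∃ λ c → UniformBound c (reaches ℓ)
    perℓ ℓ = uniformBound em (length S) (reaches ℓ)
      (λ u≤w p → ⪯-trans p (combine-mono S u≤w (⪯-refl _))) upN

    M : ℕ
    M = proj₁ (upperBound (λ ℓ → proj₁ (perℓ ℓ)) L)

    M-bounds : ∀ {ℓ} → ℓ ∈ L → proj₁ (perℓ ℓ) ≤ M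
    M-bounds = proj₂ (upperBound (λ ℓ → proj₁ (perℓ ℓ)) L)

  unreachable-below : ∀ {ℓ e} (B B' : Subset 𝔐) →
    (∀ {b} → B b → ¬ (ℓ ⪯ e ⊕ b)) → _⪯ᴮ_ 𝔐 B' B → ∀ {b'} → B' b' → ¬ (ℓ ⪯ e ⊕ b')
  unreachable-below {e = e} B B' unreachable B'⪯B b'∈B' ℓ⪯ =
    let (b , b∈B , b'⪯b) = B'⪯B b'∈B' in unreachable b∈B (⪯-trans ℓ⪯ (⊕-mono e b'⪯b))

  mus-multiple : ExcludedMiddle 0ℓ → (S : List Carrier) (A : Subset 𝔐) →
    IsArchSubsemigroup 𝔐 A → ∀ {x} → A x → ∃ λ c → IsMus 𝔐 S A (times 𝔐 c x)
  mus-multiple em S A (closed , arch) {x} ax =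
    c , times-closed A closed ax c , alternative
    where
    c : ℕ
    c = proj₁ (reachBound em S x S)

    alternative : ∀ {ℓ e} → ℓ ∈ S → Gen 𝔐 S e → (ℓ ⪯ e ⊕ times 𝔐 c x) ⊎
      ((∀ {b} → A b → ¬ (ℓ ⪯ e ⊕ b)) ×
       (∀ (B' : Subset 𝔐) → IsBlock 𝔐 B' → _⪯ᴮ_ 𝔐 B' A → ∀ {b} → B' b → ¬ (ℓ ⪯ e ⊕ b)))
    alternative {ℓ} {e} ℓ∈S g with gen-combination g | em {∃ λ b → A b × ℓ ⪯ e ⊕ b}
    ... | v , ev | yes (b , ab , ℓ⪯e⊕b) =
      let (n , b⪯nx) = arch ax ab
          ℓ⪯nx = subst (ℓ ⪯_) (ev _) (⪯-trans ℓ⪯e⊕b (⊕-mono e b⪯nx))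
      in inj₁ (subst (ℓ ⪯_) (sym (ev _)) (proj₂ (reachBound em S x S) ℓ∈S v n ℓ⪯nx))
    ... | _ | no none =
      let unreachable = λ {b} ab ℓ⪯ → none (b , ab , ℓ⪯)
      in inj₂ (unreachable , λ B' _ → unreachable-below A B' unreachable)

lemma4p28 : (∀ {ℓ} → ExcludedMiddle ℓ) →
    (𝔐 : POCSemigroup) (S : List (POCSemigroup.Carrier 𝔐))
    (B : Subset 𝔐) → IsBlock 𝔐 B →
    (∃ λ m → IsMus 𝔐 S B m)
    × ((∃ λ x → B x × Gen 𝔐 S x) → ∃ λ m → Gen 𝔐 S m × IsMus 𝔐 S B m)
lemma4p28 em 𝔐 S B ((x , bx) , archSub , _) =
  (let (c , isMus) = mus-multiple 𝔐 em S B archSub bx in times 𝔐 c x , isMus) ,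
  λ { (y , by , gy) →
        let (c , isMus) = mus-multiple 𝔐 em S B archSub by
        in times 𝔐 c y , gen-times 𝔐 c gy , isMus }
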